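{- For every $\sigma\in\{\pm1\}^n$ and every $h:X_k\to\mathbb{R}$, $$\Delta(\sigma,h)=-2^k\sum_{\emptyset\neq S\subseteq[k]}\hat Q(S)\cdot\Gamma_{|S|}(\sigma,h_S).$$
   Context: A $k$-clause is an ordered $k$-tuple of literals from $x_1,\dots,x_n,\bar x_1,\dots,\bar x_n$ with no variable repeated; $X_\ell$ is the set of $\ell$-clauses and $U_\ell$ the uniform distribution on $X_\ell$. For $\sigma\in\{\pm1\}^n$ and a clause $C$, $\sigma(C)$ is the vector of values of its literals under $\sigma$ ($-1$ = TRUE, $1$ = FALSE). $Q$ is a probability distribution on $\{\pm1\}^k$ with Fourier coefficients $\hat Q(S)=2^{ -k}\sum_yQ(y)\prod_{i\in S}y_i$, and $Q_\sigma(C)=Q(\sigma(C))/\sum_{C'\in X_k}Q(\sigma(C'))$. $\Delta(\sigma,h)=\mathbb{E}_{Q_\sigma}[h]-\mathbb{E}_{U_k}[h]$. For $\ell\in[k]$, $Z_{\ell,\sigma}$ is the planted $\ell$-XOR-SAT distribution: the uniform distribution on the $\ell$-clauses $C_\ell\in X_\ell$ having an odd number of true literals under $\sigma$ (equivalently $Z_{\ell,\sigma}(C_\ell)=(1-\prod_i\sigma(C_\ell)_i)/|X_\ell|$). For $C\in X_k$ and $S\subseteq[k]$ with $|S|=\ell$, $C_{|S}\in X_\ell$ is the clause formed by the literals of $C$ at positions in $S$ (in increasing order of position). For $h:X_k\to\mathbb{R}$, $h_S(C_\ell)=\frac{|X_\ell|}{|X_k|}\sum_{C\in X_k,\,C_{|S}=C_\ell}h(C)$.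 For $g:X_\ell\to\mathbb{R}$, $\Gamma_\ell(\sigma,g)=\mathbb{E}_{Z_{\ell,\sigma}}[g]-\mathbb{E}_{U_\ell}[g]$.
   Formalization: The function $h$ and the probability distribution $Q$ take values in ℚ rather than ℝ. -}

module Defs where

open import Data.Bool using (Bool; true; false; if_then_else_)
open import Data.Nat as ℕ using (ℕ; zero; suc)
open import Data.Integer using (+_)
open import Data.Fin using (Fin)
import Data.Fin.Properties as FinP
open import Data.Fin.Subset using (Subset; ∣_∣; inside; outside)
open import Data.Product using (_×_; _,_; proj₁)
import Data.Product.Properties as ProdP
import Data.Bool.Properties as BoolP
open import Data.Vec as Vec using (Vec; []; _∷_)
import Data.Vec.Properties as VecP
open import Data.List as List using (List; []; _∷_; filter; concatMap; length)
open import Data.Rational as ℚ using (ℚ; 0ℚ; 1ℚ; _+_; _*_; -_; _-_; _÷_; _≟_)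
open import Relation.Nullary using (yes; no)
open import Relation.Binary.Definitions using (DecidableEquality)
import Data.List.Relation.Unary.Unique.DecPropositional as UniqueDec

-- Signs ±1.  'pos' is +1 (FALSE), 'neg' is -1 (TRUE).

data PM : Set where
  pos neg : PM

flipPM : PM → PM
flipPM pos = neg
flipPM neg = pos

⟦_⟧ : PM → ℚ
⟦ pos ⟧ = 1ℚ
⟦ neg ⟧ = - 1ℚ

allVecs : {A : Set} → List A → (k : ℕ) → List (Vec A k)
allVecs xs zero    = [] ∷ []
allVecs xs (suc k) = concatMap (λ x → List.map (x ∷_) (allVecs xs k)) xs

signVecs : (k : ℕ) → List (Vec PM k)
signVecs = allVecs (pos ∷ neg ∷ [])

-- Literals over x_1..x_n: a variable and a negation flag
-- (i , false) is x_i,  (i , true) is the negated literal x̄_i.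

Lit : ℕ → Set
Lit n = Fin n × Bool

litDec : {n : ℕ} → DecidableEquality (Lit n)
litDec = ProdP.≡-dec FinP._≟_ BoolP._≟_

allLits : (n : ℕ) → List (Lit n)
allLits n = concatMap (λ i → (i , false) ∷ (i , true) ∷ []) (List.allFin n)

Tuple : ℕ → ℕ → Set
Tuple n ℓ = Vec (Lit n) ℓ

-- X_ℓ : the list of all ℓ-clauses (ordered ℓ-tuples of literals,
-- no variable repeated); each appears exactly once.
X : (n ℓ : ℕ) → List (Tuple n ℓ)
X n ℓ = filter (λ c → UniqueDec.unique? (FinP._≟_ {n}) (Vec.toList (Vec.map proj₁ c))) (allVecs (allLits n) ℓ)

Σℚ : List ℚ → ℚ
Σℚ = List.foldr _+_ 0ℚ

Σ[∈]_ : {A : Set} → List A → (A → ℚ) → ℚ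
(Σ[∈] xs) f = Σℚ (List.map f xs)

-- division q / r, with the junk value 0 when r = 0
_/′_ : ℚ → ℚ → ℚ
q /′ r with r ≟ 0ℚ
... | yes _ = 0ℚ
... | no r≢0 = _÷_ q r {{ℚ.≢-nonZero r≢0}}

ℕ→ℚ : ℕ → ℚ
ℕ→ℚ m = (+ m) ℚ./ 1

2^ : ℕ → ℚ
2^ k = ℕ→ℚ (2 ℕ.^ k)

∣X∣ : ℕ → ℕ → ℚ
∣X∣ n ℓ = ℕ→ℚ (length (X n ℓ))

litVal : {n : ℕ} → (Fin n → PM) → Lit n → PM
litVal σ (i , false) = σ i
litVal σ (i , true)  = flipPM (σ i)

σ⟨_⟩ : {n ℓ : ℕ} → (Fin n → PM) → Tuple n ℓ → Vec PM ℓ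
σ⟨ σ ⟩ C = Vec.map (litVal σ) C

∏ : {ℓ : ℕ} → Vec PM ℓ → ℚ
∏ y = Vec.foldr _ (λ s r → ⟦ s ⟧ * r) 1ℚ y

χ : {k : ℕ} → Subset k → Vec PM k → ℚ
χ []             []      = 1ℚ
χ (outside ∷ S) (y ∷ ys) = χ S ys
χ (inside ∷ S)  (y ∷ ys) = ⟦ y ⟧ * χ S ys

Q̂ : {k : ℕ} → (Vec PM k → ℚ) → Subset k → ℚ
Q̂ {k} Q S = (Σ[∈] signVecs k) (λ y → Q y * χ S y) /′ 2^ k

Qσ : (n k : ℕ) → (Vec PM k → ℚ) → (Fin n → PM) → Tuple n k → ℚ
Qσ n k Q σ C = Q (σ⟨ σ ⟩ C) /′ (Σ[∈] X n k) (λ C′ → Q (σ⟨ σ ⟩ C′))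

E-U : (n ℓ : ℕ) → (Tuple n ℓ → ℚ) → ℚ
E-U n ℓ g = (Σ[∈] X n ℓ) g /′ ∣X∣ n ℓ

Δ : (n k : ℕ) → (Vec PM k → ℚ) → (Fin n → PM) → (Tuple n k → ℚ) → ℚ
Δ n k Q σ h = (Σ[∈] X n k) (λ C → Qσ n k Q σ C * h C) - E-U n k h

Z : (n ℓ : ℕ) → (Fin n → PM) → Tuple n ℓ → ℚ
Z n ℓ σ C = (1ℚ - ∏ (σ⟨ σ ⟩ C)) /′ ∣X∣ n ℓ

Γ : (n ℓ : ℕ) → (Fin n → PM) → (Tuple n ℓ → ℚ) → ℚ
Γ n ℓ σ g = (Σ[∈] X n ℓ) (λ C → Z n ℓ σ C * g C) - E-U n ℓ g

restrict : {A : Set} {k : ℕ} → (S : Subset k) → Vec A k → Vec A ∣ S ∣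
restrict []             []      = []
restrict (outside ∷ S) (x ∷ xs) = restrict S xs
restrict (inside ∷ S)  (x ∷ xs) = x ∷ restrict S xs

tupleDec : {n ℓ : ℕ} → DecidableEquality (Tuple n ℓ)
tupleDec = VecP.≡-dec litDec

hS : (n k : ℕ) → (S : Subset k) → (Tuple n k → ℚ) → Tuple n ∣ S ∣ → ℚ
hS n k S h Cℓ =
  (∣X∣ n ∣ S ∣ * (Σ[∈] filter (λ C → tupleDec (restrict S C) Cℓ) (X n k)) h) /′ ∣X∣ n k

nonemptySubsets : (k : ℕ) → List (Subset k)
nonemptySubsets k = filter (λ S → 1 ℕ.≤? ∣ S ∣) (allVecs (inside ∷ outside ∷ []) k)

IsProbDist : (k : ℕ) → (Vec PM k → ℚ) → Set
IsProbDist k Q = ((y : Vec PM k) → 0ℚ ℚ.≤ Q y) × ((Σ[∈] signVecs k) Q ≡ 1ℚ)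
  where open import Relation.Binary.PropositionalEquality using (_≡_)

-- Write N = |X_k| and D = Σ_{C ∈ X_k} Q(σ(C)). For a fixed tuple of distinct variables, C ↦ σ(C)
-- maps the 2^k choices of signs of the literals bijectively onto {±1}^k; hence N = 2^k D (as
-- Σ_y Q(y) = 1) and Δ(σ,h) = (2^k E - H)/N, where E = Σ_C Q(σ(C)) h(C) and H = Σ_C h(C).
-- Unfolding Z_{ℓ,σ} gives Γ_ℓ(σ,g) = -(1/|X_ℓ|) Σ_{C_ℓ} ∏ σ(C_ℓ) g(C_ℓ), and grouping the clauses of
-- X_k by their restriction C_{|S} turns this into Γ_{|S|}(σ,h_S) = -(1/N) Σ_C χ_S(σ(C)) h(C).
-- By Fourier inversion, Σ_{S ≠ ∅} 2^k Q̂(S) χ_S(y) = 2^k Q(y) - 1 (since 2^k Q̂(∅) = 1), so the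
-- right-hand side is (1/N) Σ_C (2^k Q(σ(C)) - 1) h(C) as well.

{-# OPTIONS --safe #-}
module Submission where

open import Defs
open import Data.Nat using (ℕ; _≤_)
open import Data.Fin using (Fin)
open import Data.Vec using (Vec)
open import Data.Fin.Subset using (∣_∣)
open import Data.Rational using (ℚ; _*_; -_)
open import Relation.Binary.PropositionalEquality using (_≡_)

open import Data.Bool using (Bool; true; false; _∧_)
import Data.Bool.Properties as BoolP
import Data.Fin as Fin
import Data.Fin.Properties as FinP
open import Data.Fin.Subset as Subset using (Subset; inside; outside)
import Data.Integer as ℤ
import Data.Integer.Properties as ℤP
import Data.Integer.Tactic.RingSolver as ℤSolver
open import Data.List as List using (List; []; _∷_; filter; concatMap; length; _++_)
import Data.List.Properties as ListP
open import Data.List.Membership.Propositional using (_∈_)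
open import Data.List.Membership.Propositional.Properties using (∈-filter⁻)
open import Data.List.Relation.Binary.Sublist.Propositional using (_⊆_; []; _∷_; _∷ʳ_)
open import Data.List.Relation.Binary.Sublist.Propositional.Properties using (All-resp-⊆)
open import Data.List.Relation.Unary.AllPairs using ([]; _∷_)
open import Data.List.Relation.Unary.Any using (here; there)
import Data.List.Relation.Unary.Unique.DecPropositional as UniqueDec
open import Data.List.Relation.Unary.Unique.Propositional using (Unique)
open import Data.Nat as ℕ using (zero; suc)
import Data.Nat.Coprimality as Coprime
import Data.Nat.Properties as ℕP
open import Data.Product using (_,_; proj₁; proj₂)
import Data.Product.Properties as ProdP
open import Data.Rational as ℚ using (0ℚ; 1ℚ; _+_; _-_; mkℚ; toℚᵘ)
open import Data.Rational.Properties
import Data.Rational.Unnormalised as ℚᵘ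
import Data.Rational.Unnormalised.Properties as ℚᵘP
open import Data.Vec as Vec using ([]; _∷_)
import Data.Vec.Properties as VecP
open import Function using (_∘_; case_of_)
open import Relation.Binary.Definitions using (DecidableEquality)
open import Relation.Binary.PropositionalEquality
  using (_≢_; refl; sym; trans; cong; cong₂; subst; module ≡-Reasoning)
open import Relation.Nullary using (Dec; yes; no; does; contradiction)
open import Relation.Nullary.Decidable using (dec-true; dec⇒maybe)
open import Tactic.RingSolver using (solve-∀)
open import Tactic.RingSolver.Core.AlmostCommutativeRing using (AlmostCommutativeRing; fromCommutativeRing)

ℚ-ring : AlmostCommutativeRing _ _
ℚ-ring = fromCommutativeRing +-*-commutativeRing (λ x → dec⇒maybe (0ℚ ≟ x))

ι : Bool → ℚ
ι true  = 1ℚ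
ι false = 0ℚ

ι-∧ : ∀ a b → ι (a ∧ b) ≡ ι a * ι b
ι-∧ true  b = sym (*-identityˡ (ι b))
ι-∧ false b = sym (*-zeroˡ (ι b))

module _ {A : Set} where

  Σ-cong : (xs : List A) {f g : A → ℚ} → (∀ x → f x ≡ g x) → (Σ[∈] xs) f ≡ (Σ[∈] xs) g
  Σ-cong []       f≗g = refl
  Σ-cong (x ∷ xs) f≗g = cong₂ _+_ (f≗g x) (Σ-cong xs f≗g)

  Σ-cong-∈ : (xs : List A) {f g : A → ℚ} → (∀ {x} → x ∈ xs → f x ≡ g x) → (Σ[∈] xs) f ≡ (Σ[∈] xs) g
  Σ-cong-∈ []       f≗g = refl
  Σ-cong-∈ (x ∷ xs) f≗g = cong₂ _+_ (f≗g (here refl)) (Σ-cong-∈ xs (f≗g ∘ there))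

  Σ-0 : (xs : List A) → (Σ[∈] xs) (λ _ → 0ℚ) ≡ 0ℚ
  Σ-0 []       = refl
  Σ-0 (x ∷ xs) = trans (+-identityˡ _) (Σ-0 xs)

  Σ-++ : (xs ys : List A) (f : A → ℚ) → (Σ[∈] (xs ++ ys)) f ≡ (Σ[∈] xs) f + (Σ[∈] ys) f
  Σ-++ []       ys f = sym (+-identityˡ _)
  Σ-++ (x ∷ xs) ys f = trans (cong (f x +_) (Σ-++ xs ys f)) (sym (+-assoc (f x) _ _))

  Σ-+ : (xs : List A) (f g : A → ℚ) → (Σ[∈] xs) (λ x → f x + g x) ≡ (Σ[∈] xs) f + (Σ[∈] xs) g
  Σ-+ []       f g = refl
  Σ-+ (x ∷ xs) f g = trans (cong ((f x + g x) +_) (Σ-+ xs f g)) (interchange (f x) (g x) _ _)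
    where
    interchange : ∀ a b c d → (a + b) + (c + d) ≡ (a + c) + (b + d)
    interchange = solve-∀ ℚ-ring

  Σ-*ˡ : (xs : List A) (c : ℚ) (f : A → ℚ) → (Σ[∈] xs) (λ x → c * f x) ≡ c * (Σ[∈] xs) f
  Σ-*ˡ []       c f = sym (*-zeroʳ c)
  Σ-*ˡ (x ∷ xs) c f = trans (cong (c * f x +_) (Σ-*ˡ xs c f)) (sym (*-distribˡ-+ c (f x) _))

  Σ-*ʳ : (xs : List A) (c : ℚ) (f : A → ℚ) → (Σ[∈] xs) (λ x → f x * c) ≡ (Σ[∈] xs) f * c
  Σ-*ʳ xs c f = trans (Σ-cong xs (λ x → *-comm (f x) c)) (trans (Σ-*ˡ xs c f) (*-comm c _))

  Σ-linear : (xs : List A) (a b : ℚ) (f g : A → ℚ) →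
    (Σ[∈] xs) (λ x → a * f x + b * g x) ≡ a * (Σ[∈] xs) f + b * (Σ[∈] xs) g
  Σ-linear xs a b f g = trans (Σ-+ xs _ _) (cong₂ _+_ (Σ-*ˡ xs a f) (Σ-*ˡ xs b g))

  Σ-map : {B : Set} (g : B → A) (xs : List B) (f : A → ℚ) →
    (Σ[∈] List.map g xs) f ≡ (Σ[∈] xs) (λ x → f (g x))
  Σ-map g []       f = refl
  Σ-map g (x ∷ xs) f = cong (f (g x) +_) (Σ-map g xs f)

  Σ-concatMap : {B : Set} (g : B → List A) (xs : List B) (f : A → ℚ) →
    (Σ[∈] concatMap g xs) f ≡ (Σ[∈] xs) (λ x → (Σ[∈] g x) f)
  Σ-concatMap g []       f = refl
  Σ-concatMap g (x ∷ xs) f = trans (Σ-++ (g x) _ f) (cong ((Σ[∈] g x) f +_) (Σ-concatMap g xs f))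

  Σ-filter : {P : A → Set} (P? : (x : A) → Dec (P x)) (xs : List A) (f : A → ℚ) →
    (Σ[∈] filter P? xs) f ≡ (Σ[∈] xs) (λ x → ι (does (P? x)) * f x)
  Σ-filter P? []       f = refl
  Σ-filter P? (x ∷ xs) f with does (P? x)
  ... | true  = cong₂ _+_ (sym (*-identityˡ (f x))) (Σ-filter P? xs f)
  ... | false = trans (Σ-filter P? xs f) (sym (trans (cong (_+ _) (*-zeroˡ (f x))) (+-identityˡ _)))

Σ-swap : {A B : Set} (xs : List A) (ys : List B) (f : A → B → ℚ) →
  (Σ[∈] xs) (λ x → (Σ[∈] ys) (f x)) ≡ (Σ[∈] ys) (λ y → (Σ[∈] xs) (λ x → f x y))
Σ-swap []       ys f = sym (Σ-0 ys)
Σ-swap (x ∷ xs) ys f =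
  trans (cong ((Σ[∈] ys) (f x) +_) (Σ-swap xs ys f)) (sym (Σ-+ ys (f x) _))

Σ-allVecs-suc : {A : Set} (xs : List A) (k : ℕ) (f : Vec A (suc k) → ℚ) →
  (Σ[∈] allVecs xs (suc k)) f ≡ (Σ[∈] xs) (λ x → (Σ[∈] allVecs xs k) (λ v → f (x ∷ v)))
Σ-allVecs-suc xs k f =
  trans (Σ-concatMap _ xs f) (Σ-cong xs (λ x → Σ-map (x ∷_) (allVecs xs k) f))

ℕ→ℚ≡mkℚ : ∀ m → ℕ→ℚ m ≡ mkℚ (ℤ.+ m) 0 (Coprime.sym (Coprime.1-coprimeTo m))
ℕ→ℚ≡mkℚ m = normalize-coprime _

ℕ→ℚ-+ : ∀ m n → ℕ→ℚ (m ℕ.+ n) ≡ ℕ→ℚ m + ℕ→ℚ n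
ℕ→ℚ-+ m n = toℚᵘ-injective (begin
  toℚᵘ (ℕ→ℚ (m ℕ.+ n))                       ≡⟨ cong toℚᵘ (ℕ→ℚ≡mkℚ (m ℕ.+ n)) ⟩
  ℚᵘ.mkℚᵘ (ℤ.+ (m ℕ.+ n)) 0                   ≈⟨ ℚᵘ.*≡* (trans (cong (ℤ._* ℤ.+ 1) (ℤP.pos-+ m n))
                                                                     (unit-denominators (ℤ.+ m) (ℤ.+ n))) ⟩
  ℚᵘ.mkℚᵘ (ℤ.+ m) 0 ℚᵘ.+ ℚᵘ.mkℚᵘ (ℤ.+ n) 0    ≡⟨ sym (cong₂ (λ p q → toℚᵘ p ℚᵘ.+ toℚᵘ q) (ℕ→ℚ≡mkℚ m) (ℕ→ℚ≡mkℚ n)) ⟩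
  toℚᵘ (ℕ→ℚ m) ℚᵘ.+ toℚᵘ (ℕ→ℚ n)             ≈⟨ ℚᵘP.≃-sym (toℚᵘ-homo-+ (ℕ→ℚ m) (ℕ→ℚ n)) ⟩
  toℚᵘ (ℕ→ℚ m + ℕ→ℚ n)                       ∎)
  where
  open ℚᵘP.≃-Reasoning
  unit-denominators : ∀ a b → (a ℤ.+ b) ℤ.* ℤ.+ 1 ≡ (a ℤ.* ℤ.+ 1 ℤ.+ b ℤ.* ℤ.+ 1) ℤ.* ℤ.+ 1
  unit-denominators = ℤSolver.solve-∀

ℕ→ℚ≢0 : ∀ m .{{_ : ℕ.NonZero m}} → ℕ→ℚ m ≢ 0ℚ
ℕ→ℚ≢0 m m≡0 with () ← subst ℚ.Positive m≡0 (normalize-pos m 1)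

Σ-length : {A : Set} (xs : List A) → ℕ→ℚ (length xs) ≡ (Σ[∈] xs) (λ _ → 1ℚ)
Σ-length []       = refl
Σ-length (x ∷ xs) = trans (ℕ→ℚ-+ 1 (length xs)) (cong (1ℚ +_) (Σ-length xs))

2^-suc : ∀ k → 2^ (suc k) ≡ 2^ k + (2^ k + 0ℚ)
2^-suc k = trans (ℕ→ℚ-+ (2 ℕ.^ k) _) (cong (2^ k +_) (ℕ→ℚ-+ (2 ℕ.^ k) 0))

2^≢0 : ∀ k → 2^ k ≢ 0ℚ
2^≢0 k = ℕ→ℚ≢0 (2 ℕ.^ k) {{ℕP.m^n≢0 2 k}}

-- inv 0ℚ = 0ℚ, the junk value of _/′_.
inv : ℚ → ℚ
inv r = 1ℚ /′ r

/′≡*inv : ∀ q r → q /′ r ≡ q * inv r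
/′≡*inv q r with r ≟ 0ℚ
... | yes _ = sym (*-zeroʳ q)
... | no  _ = cong (q *_) (sym (*-identityˡ _))

*-inv : ∀ r → r ≢ 0ℚ → r * inv r ≡ 1ℚ
*-inv r r≢0 with r ≟ 0ℚ
... | yes r≡0 = contradiction r≡0 r≢0
... | no  r≢0 = trans (cong (r *_) (*-identityˡ _)) (*-inverseʳ r {{ℚ.≢-nonZero r≢0}})

inv-unique : ∀ r s → r * s ≡ 1ℚ → inv r ≡ s
inv-unique r s rs≡1 = begin
  inv r                ≡⟨ sym (*-identityʳ (inv r)) ⟩
  inv r * 1ℚ           ≡⟨ cong (inv r *_) (sym rs≡1) ⟩
  inv r * (r * s)      ≡⟨ sym (*-assoc (inv r) r s) ⟩
  (inv r * r) * s      ≡⟨ cong (_* s) (*-comm (inv r) r) ⟩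
  (r * inv r) * s      ≡⟨ cong (_* s) (*-inv r r≢0) ⟩
  1ℚ * s               ≡⟨ *-identityˡ s ⟩
  s                    ∎
  where
  open ≡-Reasoning
  r≢0 : r ≢ 0ℚ
  r≢0 refl = 1≢0 (trans (sym rs≡1) (*-zeroˡ s))

inv-* : ∀ r s → s ≢ 0ℚ → inv (r * s) ≡ inv r * inv s
inv-* r s s≢0 = case r ≟ 0ℚ of λ where
    (yes refl) → trans (cong inv (*-zeroˡ s)) (sym (*-zeroˡ (inv s)))
    (no r≢0)   → inv-unique (r * s) (inv r * inv s) (inverse-of-product r≢0)
  where
  open ≡-Reasoning
  regroup : ∀ a b c d → (a * b) * (c * d) ≡ (a * c) * (b * d)
  regroup = solve-∀ ℚ-ring
  inverse-of-product : r ≢ 0ℚ → (r * s) * (inv r * inv s) ≡ 1ℚ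
  inverse-of-product r≢0 = begin
    (r * s) * (inv r * inv s)    ≡⟨ regroup r s (inv r) (inv s) ⟩
    (r * inv r) * (s * inv s)    ≡⟨ cong₂ _*_ (*-inv r r≢0) (*-inv s s≢0) ⟩
    1ℚ                           ∎

Σ-/′ : {A : Set} (xs : List A) (r : ℚ) (f g : A → ℚ) →
  (Σ[∈] xs) (λ x → (f x /′ r) * g x) ≡ (Σ[∈] xs) (λ x → f x * g x) * inv r
Σ-/′ xs r f g =
  trans (Σ-cong xs (λ x → trans (cong (_* g x) (/′≡*inv (f x) r)) (*-comm-right (f x) (inv r) (g x))))
        (Σ-*ʳ xs (inv r) _)
  where
  *-comm-right : ∀ a b c → (a * b) * c ≡ (a * c) * b
  *-comm-right = solve-∀ ℚ-ring

-- Spares us proving |X_ℓ| ≠ 0: for xs = [] the sum itself vanishes.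
Σ-*inv-length : {A : Set} (xs : List A) (f : A → ℚ) →
  ℕ→ℚ (length xs) * inv (ℕ→ℚ (length xs)) * (Σ[∈] xs) f ≡ (Σ[∈] xs) f
Σ-*inv-length []       f = *-zeroʳ (ℕ→ℚ 0 * inv (ℕ→ℚ 0))
Σ-*inv-length (x ∷ xs) f =
  trans (cong (_* (Σ[∈] (x ∷ xs)) f) (*-inv _ (ℕ→ℚ≢0 (suc (length xs))))) (*-identityˡ _)

-- Every element of A occurs in xs exactly once, phrased as the sifting property of the Kronecker delta.
record Enumerates {A : Set} (_≟_ : DecidableEquality A) (xs : List A) : Set where
  constructor sifting
  field sift : ∀ a (f : A → ℚ) → (Σ[∈] xs) (λ x → ι (does (a ≟ x)) * f x) ≡ f a
open Enumerates

Σ-allFin-suc : ∀ n (f : Fin (suc n) → ℚ) →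
  (Σ[∈] List.allFin (suc n)) f ≡ f Fin.zero + (Σ[∈] List.allFin n) (f ∘ Fin.suc)
Σ-allFin-suc n f =
  cong (f Fin.zero +_) (trans (cong (λ xs → (Σ[∈] xs) f) (sym (ListP.map-tabulate (λ i → i) Fin.suc)))
                              (Σ-map Fin.suc (List.allFin n) f))

allFin-sift : ∀ n a (f : Fin n → ℚ) → (Σ[∈] List.allFin n) (λ i → ι (does (a FinP.≟ i)) * f i) ≡ f a
allFin-sift (suc n) Fin.zero f = begin
  (Σ[∈] List.allFin (suc n)) (λ i → ι (does (Fin.zero FinP.≟ i)) * f i)
    ≡⟨ Σ-allFin-suc n (λ i → ι (does (Fin.zero FinP.≟ i)) * f i) ⟩
  1ℚ * f Fin.zero + (Σ[∈] List.allFin n) (λ i → 0ℚ * f (Fin.suc i))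
    ≡⟨ cong₂ _+_ (*-identityˡ (f Fin.zero)) (Σ-cong (List.allFin n) (λ i → *-zeroˡ (f (Fin.suc i)))) ⟩
  f Fin.zero + (Σ[∈] List.allFin n) (λ _ → 0ℚ)
    ≡⟨ trans (cong (f Fin.zero +_) (Σ-0 (List.allFin n))) (+-identityʳ (f Fin.zero)) ⟩
  f Fin.zero ∎
  where open ≡-Reasoning
allFin-sift (suc n) (Fin.suc a) f = begin
  (Σ[∈] List.allFin (suc n)) (λ i → ι (does (Fin.suc a FinP.≟ i)) * f i)
    ≡⟨ Σ-allFin-suc n (λ i → ι (does (Fin.suc a FinP.≟ i)) * f i) ⟩
  0ℚ * f Fin.zero + (Σ[∈] List.allFin n) (λ i → ι (does (a FinP.≟ i)) * f (Fin.suc i))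
    ≡⟨ cong₂ _+_ (*-zeroˡ (f Fin.zero)) (allFin-sift n a (f ∘ Fin.suc)) ⟩
  0ℚ + f (Fin.suc a)
    ≡⟨ +-identityˡ (f (Fin.suc a)) ⟩
  f (Fin.suc a) ∎
  where open ≡-Reasoning

allFin-enumerates : ∀ n → Enumerates FinP._≟_ (List.allFin n)
allFin-enumerates n = sifting (allFin-sift n)

select-first : ∀ a b → 1ℚ * a + (0ℚ * b + 0ℚ) ≡ a
select-first = solve-∀ ℚ-ring

select-second : ∀ a b → 0ℚ * a + (1ℚ * b + 0ℚ) ≡ b
select-second = solve-∀ ℚ-ring

Bool-enumerates : Enumerates BoolP._≟_ (false ∷ true ∷ [])
sift Bool-enumerates false f = select-first (f false) (f true)
sift Bool-enumerates true  f = select-second (f false) (f true)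

_≟±_ : DecidableEquality PM
pos ≟± pos = yes refl
pos ≟± neg = no λ ()
neg ≟± pos = no λ ()
neg ≟± neg = yes refl

±-enumerates : Enumerates _≟±_ (pos ∷ neg ∷ [])
sift ±-enumerates pos f = select-first (f pos) (f neg)
sift ±-enumerates neg f = select-second (f pos) (f neg)

sift₂ : {A B : Set} {_≟A_ : DecidableEquality A} {_≟B_ : DecidableEquality B}
  {xs : List A} {ys : List B} → Enumerates _≟A_ xs → Enumerates _≟B_ ys → ∀ a b (f : A → B → ℚ) →
  (Σ[∈] xs) (λ x → (Σ[∈] ys) (λ y → ι (does (a ≟A x) ∧ does (b ≟B y)) * f x y)) ≡ f a b
sift₂ {_≟A_ = _≟A_} {_≟B_} {xs} {ys} enum-xs enum-ys a b f = begin
  (Σ[∈] xs) (λ x → (Σ[∈] ys) (λ y → ι (does (a ≟A x) ∧ does (b ≟B y)) * f x y))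
    ≡⟨ Σ-cong xs (λ x → Σ-cong ys (λ y → trans (cong (_* f x y) (ι-∧ (does (a ≟A x)) _))
                                                (*-assoc (ι (does (a ≟A x))) _ _))) ⟩
  (Σ[∈] xs) (λ x → (Σ[∈] ys) (λ y → ι (does (a ≟A x)) * (ι (does (b ≟B y)) * f x y)))
    ≡⟨ Σ-cong xs (λ x → Σ-*ˡ ys (ι (does (a ≟A x))) _) ⟩
  (Σ[∈] xs) (λ x → ι (does (a ≟A x)) * (Σ[∈] ys) (λ y → ι (does (b ≟B y)) * f x y))
    ≡⟨ Σ-cong xs (λ x → cong (ι (does (a ≟A x)) *_) (sift enum-ys b (f x))) ⟩
  (Σ[∈] xs) (λ x → ι (does (a ≟A x)) * f x b)
    ≡⟨ sift enum-xs a (λ x → f x b) ⟩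
  f a b ∎
  where open ≡-Reasoning

does-≡-dec-, : {A B : Set} (_≟A_ : DecidableEquality A) (_≟B_ : DecidableEquality B) (a x : A) (b y : B) →
  does (ProdP.≡-dec _≟A_ _≟B_ (a , b) (x , y)) ≡ does (a ≟A x) ∧ does (b ≟B y)
does-≡-dec-, _≟A_ _≟B_ a x b y with a ≟A x
... | yes refl = refl
... | no  _    = refl

×-enumerates : {A B : Set} {_≟A_ : DecidableEquality A} {_≟B_ : DecidableEquality B}
  {xs : List A} {ys : List B} → Enumerates _≟A_ xs → Enumerates _≟B_ ys →
  Enumerates (ProdP.≡-dec _≟A_ _≟B_) (concatMap (λ x → List.map (x ,_) ys) xs)
sift (×-enumerates {_≟A_ = _≟A_} {_≟B_} {xs} {ys} enum-xs enum-ys) (a , b) f =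
  trans (Σ-concatMap _ xs _)
  (trans (Σ-cong xs (λ x → trans (Σ-map (x ,_) ys _)
                                 (Σ-cong ys (λ y → cong (λ t → ι t * f (x , y)) (does-≡-dec-, _≟A_ _≟B_ a x b y)))))
         (sift₂ enum-xs enum-ys a b (λ x y → f (x , y))))

allVecs-enumerates : {A : Set} {_≟_ : DecidableEquality A} {xs : List A} →
  Enumerates _≟_ xs → ∀ k → Enumerates (VecP.≡-dec _≟_) (allVecs xs k)
sift (allVecs-enumerates enum-xs zero) [] f = trans (+-identityʳ _) (*-identityˡ (f []))
sift (allVecs-enumerates {xs = xs} enum-xs (suc k)) (a ∷ as) f =
  trans (Σ-allVecs-suc xs k _) (sift₂ enum-xs (allVecs-enumerates enum-xs k) a as (λ x v → f (x ∷ v)))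

allLits-enumerates : ∀ n → Enumerates litDec (allLits n)
allLits-enumerates n = ×-enumerates (allFin-enumerates n) Bool-enumerates

signVecs-enumerates : ∀ k → Enumerates (VecP.≡-dec _≟±_) (signVecs k)
signVecs-enumerates = allVecs-enumerates ±-enumerates

allSubsets : ∀ k → List (Subset k)
allSubsets = allVecs (inside ∷ outside ∷ [])

-- 2^k times the Fourier coefficient: Q̂ Q S = fourierSum Q S /′ 2^ k.
fourierSum : ∀ {k} → (Vec PM k → ℚ) → Subset k → ℚ
fourierSum {k} F S = (Σ[∈] signVecs k) (λ y → F y * χ S y)

⟦⟧*⟦⟧+1 : ∀ a b → ⟦ a ⟧ * ⟦ b ⟧ + 1ℚ ≡ ι (does (a ≟± b)) + ι (does (a ≟± b))
⟦⟧*⟦⟧+1 pos pos = refl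
⟦⟧*⟦⟧+1 pos neg = refl
⟦⟧*⟦⟧+1 neg pos = refl
⟦⟧*⟦⟧+1 neg neg = refl

χ-orthogonal : ∀ k (y z : Vec PM k) →
  (Σ[∈] allSubsets k) (λ S → χ S y * χ S z) ≡ 2^ k * ι (does (VecP.≡-dec _≟±_ y z))
χ-orthogonal zero    []      []      = refl
χ-orthogonal (suc k) (a ∷ y) (b ∷ z) = begin
  (Σ[∈] allSubsets (suc k)) (λ S → χ S (a ∷ y) * χ S (b ∷ z))
    ≡⟨ Σ-allVecs-suc (inside ∷ outside ∷ []) k _ ⟩
  (Σ[∈] allSubsets k) (λ S → (⟦ a ⟧ * χ S y) * (⟦ b ⟧ * χ S z)) + (O + 0ℚ)
    ≡⟨ cong (_+ (O + 0ℚ)) (trans (Σ-cong (allSubsets k) (λ S → interchange ⟦ a ⟧ (χ S y) ⟦ b ⟧ (χ S z)))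
                                 (Σ-*ˡ (allSubsets k) (⟦ a ⟧ * ⟦ b ⟧) _)) ⟩
  ⟦ a ⟧ * ⟦ b ⟧ * O + (O + 0ℚ)
    ≡⟨ factor (⟦ a ⟧ * ⟦ b ⟧) O ⟩
  (⟦ a ⟧ * ⟦ b ⟧ + 1ℚ) * O
    ≡⟨ cong₂ _*_ (⟦⟧*⟦⟧+1 a b) (χ-orthogonal k y z) ⟩
  (ι (does (a ≟± b)) + ι (does (a ≟± b))) * (2^ k * δ)
    ≡⟨ regroup (ι (does (a ≟± b))) (2^ k) δ ⟩
  (2^ k + (2^ k + 0ℚ)) * (ι (does (a ≟± b)) * δ)
    ≡⟨ cong₂ _*_ (sym (2^-suc k)) (sym (ι-∧ (does (a ≟± b)) _)) ⟩
  2^ (suc k) * ι (does (VecP.≡-dec _≟±_ (a ∷ y) (b ∷ z))) ∎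
  where
  open ≡-Reasoning
  O = (Σ[∈] allSubsets k) (λ S → χ S y * χ S z)
  δ = ι (does (VecP.≡-dec _≟±_ y z))
  interchange : ∀ u v w x → (u * v) * (w * x) ≡ (u * w) * (v * x)
  interchange = solve-∀ ℚ-ring
  factor : ∀ u o → u * o + (o + 0ℚ) ≡ (u + 1ℚ) * o
  factor = solve-∀ ℚ-ring
  regroup : ∀ e p d → (e + e) * (p * d) ≡ (p + (p + 0ℚ)) * (e * d)
  regroup = solve-∀ ℚ-ring

fourier-inversion : ∀ k (F : Vec PM k → ℚ) z →
  (Σ[∈] allSubsets k) (λ S → fourierSum F S * χ S z) ≡ 2^ k * F z
fourier-inversion k F z = begin
  (Σ[∈] allSubsets k) (λ S → fourierSum F S * χ S z)
    ≡⟨ Σ-cong (allSubsets k) (λ S → sym (Σ-*ʳ (signVecs k) (χ S z) _)) ⟩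
  (Σ[∈] allSubsets k) (λ S → (Σ[∈] signVecs k) (λ y → (F y * χ S y) * χ S z))
    ≡⟨ Σ-swap (allSubsets k) (signVecs k) _ ⟩
  (Σ[∈] signVecs k) (λ y → (Σ[∈] allSubsets k) (λ S → (F y * χ S y) * χ S z))
    ≡⟨ Σ-cong (signVecs k) (λ y → trans (Σ-cong (allSubsets k) (λ S → rearrange (F y) (χ S y) (χ S z)))
                                        (Σ-*ˡ (allSubsets k) (F y) _)) ⟩
  (Σ[∈] signVecs k) (λ y → F y * (Σ[∈] allSubsets k) (λ S → χ S z * χ S y))
    ≡⟨ Σ-cong (signVecs k) (λ y → trans (cong (F y *_) (χ-orthogonal k z y)) (swap (F y) (2^ k) _)) ⟩
  (Σ[∈] signVecs k) (λ y → 2^ k * (ι (does (VecP.≡-dec _≟±_ z y)) * F y))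
    ≡⟨ Σ-*ˡ (signVecs k) (2^ k) _ ⟩
  2^ k * (Σ[∈] signVecs k) (λ y → ι (does (VecP.≡-dec _≟±_ z y)) * F y)
    ≡⟨ cong (2^ k *_) (sift (signVecs-enumerates k) z F) ⟩
  2^ k * F z ∎
  where
  open ≡-Reasoning
  rearrange : ∀ f u v → (f * u) * v ≡ f * (v * u)
  rearrange = solve-∀ ℚ-ring
  swap : ∀ f p d → f * (p * d) ≡ p * (d * f)
  swap = solve-∀ ℚ-ring

χ-⊥ : ∀ {k} (y : Vec PM k) → χ Subset.⊥ y ≡ 1ℚ
χ-⊥ []      = refl
χ-⊥ (_ ∷ y) = χ-⊥ y

Σ-allSubsets-split : ∀ k (G : Subset k → ℚ) →
  (Σ[∈] allSubsets k) G ≡ G Subset.⊥ + (Σ[∈] allSubsets k) (λ S → ι (does (1 ℕ.≤? ∣ S ∣)) * G S)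
Σ-allSubsets-split zero    G = cong (G [] +_) (sym (cong (_+ 0ℚ) (*-zeroˡ (G []))))
Σ-allSubsets-split (suc k) G = begin
  (Σ[∈] allSubsets (suc k)) G
    ≡⟨ Σ-allVecs-suc (inside ∷ outside ∷ []) k G ⟩
  (Σ[∈] allSubsets k) (λ S → G (inside ∷ S)) + ((Σ[∈] allSubsets k) (λ S → G (outside ∷ S)) + 0ℚ)
    ≡⟨ cong (λ t → I + (t + 0ℚ)) (Σ-allSubsets-split k (λ S → G (outside ∷ S))) ⟩
  I + ((G Subset.⊥ + O) + 0ℚ)
    ≡⟨ reorder I (G Subset.⊥) O ⟩
  G Subset.⊥ + (I + (O + 0ℚ))
    ≡⟨ cong (λ t → G Subset.⊥ + (t + (O + 0ℚ))) (sym (Σ-cong (allSubsets k) (λ S → *-identityˡ (G (inside ∷ S))))) ⟩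
  G Subset.⊥ + ((Σ[∈] allSubsets k) (λ S → 1ℚ * G (inside ∷ S)) + (O + 0ℚ))
    ≡⟨ cong (G Subset.⊥ +_) (sym (Σ-allVecs-suc (inside ∷ outside ∷ []) k (λ S → ι (does (1 ℕ.≤? ∣ S ∣)) * G S))) ⟩
  G Subset.⊥ + (Σ[∈] allSubsets (suc k)) (λ S → ι (does (1 ℕ.≤? ∣ S ∣)) * G S) ∎
  where
  open ≡-Reasoning
  I = (Σ[∈] allSubsets k) (λ S → G (inside ∷ S))
  O = (Σ[∈] allSubsets k) (λ S → ι (does (1 ℕ.≤? ∣ S ∣)) * G (outside ∷ S))
  reorder : ∀ i e o → i + ((e + o) + 0ℚ) ≡ e + (i + (o + 0ℚ))
  reorder = solve-∀ ℚ-ring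

nonempty-fourier-inversion : ∀ k (F : Vec PM k → ℚ) → (Σ[∈] signVecs k) F ≡ 1ℚ → ∀ z →
  (Σ[∈] nonemptySubsets k) (λ S → fourierSum F S * χ S z) ≡ 2^ k * F z - 1ℚ
nonempty-fourier-inversion k F ΣF≡1 z = begin
  Σne                  ≡⟨ add-sub (fourierSum F Subset.⊥ * χ Subset.⊥ z) Σne ⟩
  (fourierSum F Subset.⊥ * χ Subset.⊥ z + Σne) - fourierSum F Subset.⊥ * χ Subset.⊥ z
    ≡⟨ cong₂ _-_ (sym whole) empty-term ⟩
  2^ k * F z - 1ℚ      ∎
  where
  open ≡-Reasoning
  Σne = (Σ[∈] nonemptySubsets k) (λ S → fourierSum F S * χ S z)
  add-sub : ∀ c b → b ≡ (c + b) - c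
  add-sub = solve-∀ ℚ-ring
  whole : 2^ k * F z ≡ fourierSum F Subset.⊥ * χ Subset.⊥ z + Σne
  whole = trans (sym (fourier-inversion k F z))
    (trans (Σ-allSubsets-split k _)
           (cong (fourierSum F Subset.⊥ * χ Subset.⊥ z +_)
                 (sym (Σ-filter (λ S → 1 ℕ.≤? ∣ S ∣) (allSubsets k) (λ S → fourierSum F S * χ S z)))))
  empty-term : fourierSum F Subset.⊥ * χ Subset.⊥ z ≡ 1ℚ
  empty-term = begin
    fourierSum F Subset.⊥ * χ Subset.⊥ z
      ≡⟨ cong₂ _*_ (Σ-cong (signVecs k) (λ y → trans (cong (F y *_) (χ-⊥ y)) (*-identityʳ (F y)))) (χ-⊥ z) ⟩
    (Σ[∈] signVecs k) F * 1ℚ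
      ≡⟨ trans (*-identityʳ _) ΣF≡1 ⟩
    1ℚ ∎

vars : ∀ {n k} → Tuple n k → Vec (Fin n) k
vars = Vec.map proj₁

uniqueVec? : ∀ {n k} (v : Vec (Fin n) k) → Dec (Unique (Vec.toList v))
uniqueVec? v = UniqueDec.unique? FinP._≟_ (Vec.toList v)

Σ-litVal : ∀ {n} (σ : Fin n → PM) i (g : PM → ℚ) →
  (Σ[∈] (false ∷ true ∷ [])) (λ b → g (litVal σ (i , b))) ≡ (Σ[∈] (pos ∷ neg ∷ [])) g
Σ-litVal σ i g with σ i
... | pos = refl
... | neg = swap (g neg) (g pos)
  where
  swap : ∀ a b → a + (b + 0ℚ) ≡ b + (a + 0ℚ)
  swap = solve-∀ ℚ-ring

Σ-tuples-σ : ∀ n k (σ : Fin n → PM) (F : Vec (Fin n) k → Vec PM k → ℚ) →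
  (Σ[∈] allVecs (allLits n) k) (λ C → F (vars C) (σ⟨ σ ⟩ C))
    ≡ (Σ[∈] allVecs (List.allFin n) k) (λ v → (Σ[∈] signVecs k) (F v))
Σ-tuples-σ n zero    σ F = sym (+-identityʳ _)
Σ-tuples-σ n (suc k) σ F = begin
  (Σ[∈] allVecs (allLits n) (suc k)) (λ C → F (vars C) (σ⟨ σ ⟩ C))
    ≡⟨ Σ-allVecs-suc (allLits n) k _ ⟩
  (Σ[∈] allLits n) (λ x → (Σ[∈] allVecs (allLits n) k) (λ C → F (proj₁ x ∷ vars C) (litVal σ x ∷ σ⟨ σ ⟩ C)))
    ≡⟨ Σ-cong (allLits n) (λ x → Σ-tuples-σ n k σ (λ v y → F (proj₁ x ∷ v) (litVal σ x ∷ y))) ⟩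
  (Σ[∈] allLits n) (λ x → G (proj₁ x) (litVal σ x))
    ≡⟨ Σ-concatMap _ (List.allFin n) _ ⟩
  (Σ[∈] List.allFin n) (λ i → (Σ[∈] (false ∷ true ∷ [])) (λ b → G i (litVal σ (i , b))))
    ≡⟨ Σ-cong (List.allFin n) (λ i → Σ-litVal σ i (G i)) ⟩
  (Σ[∈] List.allFin n) (λ i → (Σ[∈] (pos ∷ neg ∷ [])) (G i))
    ≡⟨ Σ-cong (List.allFin n) (λ i → Σ-swap (pos ∷ neg ∷ []) (allVecs (List.allFin n) k)
                                         (λ s v → (Σ[∈] signVecs k) (λ y → F (i ∷ v) (s ∷ y)))) ⟩
  (Σ[∈] List.allFin n) (λ i → (Σ[∈] allVecs (List.allFin n) k) (λ v →
                                 (Σ[∈] (pos ∷ neg ∷ [])) (λ s → (Σ[∈] signVecs k) (λ y → F (i ∷ v) (s ∷ y)))))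
    ≡⟨ Σ-cong (List.allFin n) (λ i → Σ-cong (allVecs (List.allFin n) k) (λ v →
                                       sym (Σ-allVecs-suc (pos ∷ neg ∷ []) k (F (i ∷ v))))) ⟩
  (Σ[∈] List.allFin n) (λ i → (Σ[∈] allVecs (List.allFin n) k) (λ v → (Σ[∈] signVecs (suc k)) (F (i ∷ v))))
    ≡⟨ sym (Σ-allVecs-suc (List.allFin n) k _) ⟩
  (Σ[∈] allVecs (List.allFin n) (suc k)) (λ v → (Σ[∈] signVecs (suc k)) (F v)) ∎
  where
  open ≡-Reasoning
  G : Fin n → PM → ℚ
  G i s = (Σ[∈] allVecs (List.allFin n) k) (λ v → (Σ[∈] signVecs k) (λ y → F (i ∷ v) (s ∷ y)))

distinctVarTuples : ℕ → ℕ → ℚ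
distinctVarTuples n k = (Σ[∈] allVecs (List.allFin n) k) (λ v → ι (does (uniqueVec? v)))

Σ-X-σ : ∀ n k (σ : Fin n → PM) (f : Vec PM k → ℚ) →
  (Σ[∈] X n k) (λ C → f (σ⟨ σ ⟩ C)) ≡ distinctVarTuples n k * (Σ[∈] signVecs k) f
Σ-X-σ n k σ f = begin
  (Σ[∈] X n k) (λ C → f (σ⟨ σ ⟩ C))
    ≡⟨ Σ-filter (λ C → uniqueVec? (vars C)) (allVecs (allLits n) k) _ ⟩
  (Σ[∈] allVecs (allLits n) k) (λ C → ι (does (uniqueVec? (vars C))) * f (σ⟨ σ ⟩ C))
    ≡⟨ Σ-tuples-σ n k σ (λ v y → ι (does (uniqueVec? v)) * f y) ⟩
  (Σ[∈] allVecs (List.allFin n) k) (λ v → (Σ[∈] signVecs k) (λ y → ι (does (uniqueVec? v)) * f y))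
    ≡⟨ Σ-cong (allVecs (List.allFin n) k) (λ v → Σ-*ˡ (signVecs k) (ι (does (uniqueVec? v))) f) ⟩
  (Σ[∈] allVecs (List.allFin n) k) (λ v → ι (does (uniqueVec? v)) * (Σ[∈] signVecs k) f)
    ≡⟨ Σ-*ʳ (allVecs (List.allFin n) k) ((Σ[∈] signVecs k) f) _ ⟩
  distinctVarTuples n k * (Σ[∈] signVecs k) f ∎
  where open ≡-Reasoning

Σ-signVecs-1 : ∀ k → (Σ[∈] signVecs k) (λ _ → 1ℚ) ≡ 2^ k
Σ-signVecs-1 zero    = refl
Σ-signVecs-1 (suc k) =
  trans (Σ-allVecs-suc (pos ∷ neg ∷ []) k _)
        (trans (cong (λ t → t + (t + 0ℚ)) (Σ-signVecs-1 k)) (sym (2^-suc k)))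

∣X∣≡Σ[Qσ]*2^ : ∀ n k (Q : Vec PM k → ℚ) → (Σ[∈] signVecs k) Q ≡ 1ℚ → (σ : Fin n → PM) →
  ∣X∣ n k ≡ (Σ[∈] X n k) (λ C → Q (σ⟨ σ ⟩ C)) * 2^ k
∣X∣≡Σ[Qσ]*2^ n k Q ΣQ≡1 σ = begin
  ∣X∣ n k                                       ≡⟨ Σ-length (X n k) ⟩
  (Σ[∈] X n k) (λ _ → 1ℚ)                       ≡⟨ Σ-X-σ n k σ (λ _ → 1ℚ) ⟩
  distinctVarTuples n k * (Σ[∈] signVecs k) (λ _ → 1ℚ)  ≡⟨ cong (distinctVarTuples n k *_) (Σ-signVecs-1 k) ⟩
  distinctVarTuples n k * 2^ k                  ≡⟨ cong (_* 2^ k) (sym (*-identityʳ (distinctVarTuples n k))) ⟩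
  distinctVarTuples n k * 1ℚ * 2^ k             ≡⟨ cong (λ t → distinctVarTuples n k * t * 2^ k) (sym ΣQ≡1) ⟩
  distinctVarTuples n k * (Σ[∈] signVecs k) Q * 2^ k  ≡⟨ cong (_* 2^ k) (sym (Σ-X-σ n k σ Q)) ⟩
  (Σ[∈] X n k) (λ C → Q (σ⟨ σ ⟩ C)) * 2^ k      ∎
  where open ≡-Reasoning

Γ≡-Σ∏ : ∀ n ℓ (σ : Fin n → PM) (g : Tuple n ℓ → ℚ) →
  Γ n ℓ σ g ≡ - ((Σ[∈] X n ℓ) (λ C → ∏ (σ⟨ σ ⟩ C) * g C) * inv (∣X∣ n ℓ))
Γ≡-Σ∏ n ℓ σ g = begin
  Γ n ℓ σ g
    ≡⟨ cong₂ _-_ (Σ-cong (X n ℓ) (λ C → trans (cong (_* g C) (/′≡*inv _ (∣X∣ n ℓ))) (expand (∏ (σ⟨ σ ⟩ C)) i (g C))))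
                 (/′≡*inv _ (∣X∣ n ℓ)) ⟩
  (Σ[∈] X n ℓ) (λ C → i * g C + (- i) * (∏ (σ⟨ σ ⟩ C) * g C)) - (Σ[∈] X n ℓ) g * i
    ≡⟨ cong (_- (Σ[∈] X n ℓ) g * i) (Σ-linear (X n ℓ) i (- i) g _) ⟩
  (i * (Σ[∈] X n ℓ) g + (- i) * Σ∏g) - (Σ[∈] X n ℓ) g * i
    ≡⟨ cancel i ((Σ[∈] X n ℓ) g) Σ∏g ⟩
  - (Σ∏g * i) ∎
  where
  open ≡-Reasoning
  i = inv (∣X∣ n ℓ)
  Σ∏g = (Σ[∈] X n ℓ) (λ C → ∏ (σ⟨ σ ⟩ C) * g C)
  expand : ∀ p i x → ((1ℚ - p) * i) * x ≡ i * x + (- i) * (p * x)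
  expand = solve-∀ ℚ-ring
  cancel : ∀ i s t → (i * s + (- i) * t) - s * i ≡ - (t * i)
  cancel = solve-∀ ℚ-ring

restrict-map : ∀ {A B : Set} {k} (g : A → B) (S : Subset k) (v : Vec A k) →
  restrict S (Vec.map g v) ≡ Vec.map g (restrict S v)
restrict-map g []            []      = refl
restrict-map g (outside ∷ S) (x ∷ v) = restrict-map g S v
restrict-map g (inside ∷ S)  (x ∷ v) = cong (g x ∷_) (restrict-map g S v)

∏-restrict : ∀ {k} (S : Subset k) (y : Vec PM k) → ∏ (restrict S y) ≡ χ S y
∏-restrict []            []      = refl
∏-restrict (outside ∷ S) (a ∷ y) = ∏-restrict S y
∏-restrict (inside ∷ S)  (a ∷ y) = cong (⟦ a ⟧ *_) (∏-restrict S y)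

toList-restrict-⊆ : ∀ {A : Set} {k} (S : Subset k) (v : Vec A k) → Vec.toList (restrict S v) ⊆ Vec.toList v
toList-restrict-⊆ []            []      = []
toList-restrict-⊆ (outside ∷ S) (x ∷ v) = x ∷ʳ toList-restrict-⊆ S v
toList-restrict-⊆ (inside ∷ S)  (x ∷ v) = refl ∷ toList-restrict-⊆ S v

Unique-resp-⊇ : ∀ {A : Set} {xs ys : List A} → ys ⊆ xs → Unique xs → Unique ys
Unique-resp-⊇ []         []         = []
Unique-resp-⊇ (x ∷ʳ p)   (_ ∷ u)    = Unique-resp-⊇ p u
Unique-resp-⊇ (refl ∷ p) (x∉ ∷ u)   = All-resp-⊆ p x∉ ∷ Unique-resp-⊇ p u

unique-vars-restrict : ∀ {n k} (S : Subset k) (C : Tuple n k) →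
  Unique (Vec.toList (vars C)) → Unique (Vec.toList (vars (restrict S C)))
unique-vars-restrict S C u =
  subst (Unique ∘ Vec.toList) (restrict-map proj₁ S C) (Unique-resp-⊇ (toList-restrict-⊆ S (vars C)) u)

X-sift : ∀ n ℓ (C : Tuple n ℓ) → Unique (Vec.toList (vars C)) → (g : Tuple n ℓ → ℚ) →
  (Σ[∈] X n ℓ) (λ D → ι (does (tupleDec C D)) * g D) ≡ g C
X-sift n ℓ C u g = begin
  (Σ[∈] X n ℓ) (λ D → ι (does (tupleDec C D)) * g D)
    ≡⟨ Σ-filter (λ D → uniqueVec? (vars D)) (allVecs (allLits n) ℓ) _ ⟩
  (Σ[∈] allVecs (allLits n) ℓ) (λ D → ι (does (uniqueVec? (vars D))) * (ι (does (tupleDec C D)) * g D))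
    ≡⟨ Σ-cong (allVecs (allLits n) ℓ) (λ D → *-comm-middle (ι (does (uniqueVec? (vars D))))
                                                           (ι (does (tupleDec C D))) (g D)) ⟩
  (Σ[∈] allVecs (allLits n) ℓ) (λ D → ι (does (tupleDec C D)) * (ι (does (uniqueVec? (vars D))) * g D))
    ≡⟨ sift (allVecs-enumerates (allLits-enumerates n) ℓ) C _ ⟩
  ι (does (uniqueVec? (vars C))) * g C
    ≡⟨ cong (λ b → ι b * g C) (dec-true (uniqueVec? (vars C)) u) ⟩
  1ℚ * g C
    ≡⟨ *-identityˡ (g C) ⟩
  g C ∎
  where
  open ≡-Reasoning
  *-comm-middle : ∀ a b c → a * (b * c) ≡ b * (a * c)
  *-comm-middle = solve-∀ ℚ-ring

Σ-fibres : {A B : Set} (_≟_ : DecidableEquality B) (r : A → B) (xs : List A) (ys : List B)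
  (g : B → ℚ) (h : A → ℚ) →
  (∀ {x} → x ∈ xs → (Σ[∈] ys) (λ y → ι (does (r x ≟ y)) * g y) ≡ g (r x)) →
  (Σ[∈] ys) (λ y → g y * (Σ[∈] filter (λ x → r x ≟ y) xs) h) ≡ (Σ[∈] xs) (λ x → g (r x) * h x)
Σ-fibres _≟_ r xs ys g h sifts = begin
  (Σ[∈] ys) (λ y → g y * (Σ[∈] filter (λ x → r x ≟ y) xs) h)
    ≡⟨ Σ-cong ys (λ y → trans (cong (g y *_) (Σ-filter (λ x → r x ≟ y) xs h)) (sym (Σ-*ˡ xs (g y) _))) ⟩
  (Σ[∈] ys) (λ y → (Σ[∈] xs) (λ x → g y * (ι (does (r x ≟ y)) * h x)))
    ≡⟨ Σ-swap ys xs _ ⟩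
  (Σ[∈] xs) (λ x → (Σ[∈] ys) (λ y → g y * (ι (does (r x ≟ y)) * h x)))
    ≡⟨ Σ-cong xs (λ x → trans (Σ-cong ys (λ y → regroup (g y) (ι (does (r x ≟ y))) (h x))) (Σ-*ʳ ys (h x) _)) ⟩
  (Σ[∈] xs) (λ x → (Σ[∈] ys) (λ y → ι (does (r x ≟ y)) * g y) * h x)
    ≡⟨ Σ-cong-∈ xs (λ x∈xs → cong (_* h _) (sifts x∈xs)) ⟩
  (Σ[∈] xs) (λ x → g (r x) * h x) ∎
  where
  open ≡-Reasoning
  regroup : ∀ a d c → a * (d * c) ≡ (d * a) * c
  regroup = solve-∀ ℚ-ring

χ-correlation : ∀ n k → (Fin n → PM) → Subset k → (Tuple n k → ℚ) → ℚ
χ-correlation n k σ S h = (Σ[∈] X n k) (λ C → χ S (σ⟨ σ ⟩ C) * h C)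

Σ-∏-fibres : ∀ n k (σ : Fin n → PM) (S : Subset k) (h : Tuple n k → ℚ) →
  (Σ[∈] X n ∣ S ∣) (λ D → ∏ (σ⟨ σ ⟩ D) * (Σ[∈] filter (λ C → tupleDec (restrict S C) D) (X n k)) h)
    ≡ χ-correlation n k σ S h
Σ-∏-fibres n k σ S h =
  trans (Σ-fibres tupleDec (restrict S) (X n k) (X n ∣ S ∣) (λ D → ∏ (σ⟨ σ ⟩ D)) h restriction-sifts)
        (Σ-cong (X n k) (λ C → cong (_* h C) (trans (cong ∏ (sym (restrict-map (litVal σ) S C)))
                                                     (∏-restrict S (σ⟨ σ ⟩ C)))))
  where
  restriction-sifts : ∀ {C} → C ∈ X n k →
    (Σ[∈] X n ∣ S ∣) (λ D → ι (does (tupleDec (restrict S C) D)) * ∏ (σ⟨ σ ⟩ D)) ≡ ∏ (σ⟨ σ ⟩ (restrict S C))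
  restriction-sifts {C} C∈X =
    X-sift n ∣ S ∣ (restrict S C) (unique-vars-restrict S C unique-C) _
    where
    unique-C = proj₂ (∈-filter⁻ (λ D → uniqueVec? (vars D)) {xs = allVecs (allLits n) k} C∈X)

Γ-hS : ∀ n k (σ : Fin n → PM) (S : Subset k) (h : Tuple n k → ℚ) →
  Γ n ∣ S ∣ σ (hS n k S h) ≡ - (χ-correlation n k σ S h * inv (∣X∣ n k))
Γ-hS n k σ S h = begin
  Γ n ∣ S ∣ σ (hS n k S h)
    ≡⟨ Γ≡-Σ∏ n ∣ S ∣ σ (hS n k S h) ⟩
  - ((Σ[∈] X n ∣ S ∣) (λ D → ∏ (σ⟨ σ ⟩ D) * hS n k S h D) * iℓ)
    ≡⟨ cong (λ t → - (t * iℓ)) (trans (Σ-cong (X n ∣ S ∣) term) (Σ-*ˡ (X n ∣ S ∣) (Nℓ * iN) _)) ⟩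
  - ((Nℓ * iN) * Σ∏B * iℓ)
    ≡⟨ cong -_ (reassociate Nℓ iN Σ∏B iℓ) ⟩
  - (iN * (Nℓ * iℓ * Σ∏B))
    ≡⟨ cong (λ t → - (iN * t)) (Σ-*inv-length (X n ∣ S ∣) _) ⟩
  - (iN * Σ∏B)
    ≡⟨ cong (λ t → - (iN * t)) (Σ-∏-fibres n k σ S h) ⟩
  - (iN * χ-correlation n k σ S h)
    ≡⟨ cong -_ (*-comm iN _) ⟩
  - (χ-correlation n k σ S h * iN) ∎
  where
  open ≡-Reasoning
  Nℓ = ∣X∣ n ∣ S ∣
  iℓ = inv Nℓ
  iN = inv (∣X∣ n k)
  B : Tuple n ∣ S ∣ → ℚ
  B D = (Σ[∈] filter (λ C → tupleDec (restrict S C) D) (X n k)) h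
  Σ∏B = (Σ[∈] X n ∣ S ∣) (λ D → ∏ (σ⟨ σ ⟩ D) * B D)
  regroup : ∀ p a b j → p * ((a * b) * j) ≡ (a * j) * (p * b)
  regroup = solve-∀ ℚ-ring
  reassociate : ∀ a j x i → (a * j) * x * i ≡ j * (a * i * x)
  reassociate = solve-∀ ℚ-ring
  term : ∀ D → ∏ (σ⟨ σ ⟩ D) * hS n k S h D ≡ (Nℓ * iN) * (∏ (σ⟨ σ ⟩ D) * B D)
  term D = trans (cong (∏ (σ⟨ σ ⟩ D) *_) (/′≡*inv _ (∣X∣ n k))) (regroup (∏ (σ⟨ σ ⟩ D)) Nℓ (B D) iN)

Σ-nonempty-correlation : ∀ n k (Q : Vec PM k → ℚ) → (Σ[∈] signVecs k) Q ≡ 1ℚ →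
  (σ : Fin n → PM) (h : Tuple n k → ℚ) →
  (Σ[∈] nonemptySubsets k) (λ S → fourierSum Q S * χ-correlation n k σ S h)
    ≡ 2^ k * (Σ[∈] X n k) (λ C → Q (σ⟨ σ ⟩ C) * h C) - (Σ[∈] X n k) h
Σ-nonempty-correlation n k Q ΣQ≡1 σ h = begin
  (Σ[∈] nonemptySubsets k) (λ S → fourierSum Q S * χ-correlation n k σ S h)
    ≡⟨ Σ-cong (nonemptySubsets k) (λ S → sym (Σ-*ˡ (X n k) (fourierSum Q S) _)) ⟩
  (Σ[∈] nonemptySubsets k) (λ S → (Σ[∈] X n k) (λ C → fourierSum Q S * (χ S (σ⟨ σ ⟩ C) * h C)))
    ≡⟨ Σ-swap (nonemptySubsets k) (X n k) _ ⟩
  (Σ[∈] X n k) (λ C → (Σ[∈] nonemptySubsets k) (λ S → fourierSum Q S * (χ S (σ⟨ σ ⟩ C) * h C)))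
    ≡⟨ Σ-cong (X n k) (λ C → trans (Σ-cong (nonemptySubsets k) (λ S → sym (*-assoc (fourierSum Q S) _ (h C))))
                                   (Σ-*ʳ (nonemptySubsets k) (h C) _)) ⟩
  (Σ[∈] X n k) (λ C → (Σ[∈] nonemptySubsets k) (λ S → fourierSum Q S * χ S (σ⟨ σ ⟩ C)) * h C)
    ≡⟨ Σ-cong (X n k) (λ C → trans (cong (_* h C) (nonempty-fourier-inversion k Q ΣQ≡1 (σ⟨ σ ⟩ C)))
                                   (expand (2^ k) (Q (σ⟨ σ ⟩ C)) (h C))) ⟩
  (Σ[∈] X n k) (λ C → 2^ k * (Q (σ⟨ σ ⟩ C) * h C) + (- 1ℚ) * h C)
    ≡⟨ Σ-linear (X n k) (2^ k) (- 1ℚ) _ h ⟩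
  2^ k * (Σ[∈] X n k) (λ C → Q (σ⟨ σ ⟩ C) * h C) + (- 1ℚ) * (Σ[∈] X n k) h
    ≡⟨ minus-one (2^ k * (Σ[∈] X n k) (λ C → Q (σ⟨ σ ⟩ C) * h C)) ((Σ[∈] X n k) h) ⟩
  2^ k * (Σ[∈] X n k) (λ C → Q (σ⟨ σ ⟩ C) * h C) - (Σ[∈] X n k) h ∎
  where
  open ≡-Reasoning
  expand : ∀ p q x → (p * q - 1ℚ) * x ≡ p * (q * x) + (- 1ℚ) * x
  expand = solve-∀ ℚ-ring
  minus-one : ∀ a b → a + (- 1ℚ) * b ≡ a - b
  minus-one = solve-∀ ℚ-ring

inv-∣X∣*2^ : ∀ n k (Q : Vec PM k → ℚ) → (Σ[∈] signVecs k) Q ≡ 1ℚ → (σ : Fin n → PM) →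
  inv (∣X∣ n k) * 2^ k ≡ inv ((Σ[∈] X n k) (λ C → Q (σ⟨ σ ⟩ C)))
inv-∣X∣*2^ n k Q ΣQ≡1 σ = begin
  inv (∣X∣ n k) * 2^ k             ≡⟨ cong (λ t → inv t * 2^ k) (∣X∣≡Σ[Qσ]*2^ n k Q ΣQ≡1 σ) ⟩
  inv (D * 2^ k) * 2^ k            ≡⟨ cong (_* 2^ k) (inv-* D (2^ k) (2^≢0 k)) ⟩
  inv D * inv (2^ k) * 2^ k        ≡⟨ *-assoc (inv D) _ _ ⟩
  inv D * (inv (2^ k) * 2^ k)      ≡⟨ cong (inv D *_) (trans (*-comm _ (2^ k)) (*-inv (2^ k) (2^≢0 k))) ⟩
  inv D * 1ℚ                       ≡⟨ *-identityʳ (inv D) ⟩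
  inv D                            ∎
  where
  open ≡-Reasoning
  D = (Σ[∈] X n k) (λ C → Q (σ⟨ σ ⟩ C))

Σ-Q̂-Γ : ∀ n k (Q : Vec PM k → ℚ) (σ : Fin n → PM) (h : Tuple n k → ℚ) →
  - (2^ k * (Σ[∈] nonemptySubsets k) (λ S → Q̂ Q S * Γ n ∣ S ∣ σ (hS n k S h)))
    ≡ inv (∣X∣ n k) * (Σ[∈] nonemptySubsets k) (λ S → fourierSum Q S * χ-correlation n k σ S h)
Σ-Q̂-Γ n k Q σ h = begin
  - (2^ k * (Σ[∈] nonemptySubsets k) (λ S → Q̂ Q S * Γ n ∣ S ∣ σ (hS n k S h)))
    ≡⟨ cong (λ t → - (2^ k * t)) (Σ-cong (nonemptySubsets k) term) ⟩
  - (2^ k * (Σ[∈] nonemptySubsets k) (λ S → - (i * iN) * (fourierSum Q S * T S)))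
    ≡⟨ cong (λ t → - (2^ k * t)) (Σ-*ˡ (nonemptySubsets k) (- (i * iN)) _) ⟩
  - (2^ k * (- (i * iN) * Σ))
    ≡⟨ double-neg (2^ k) i iN Σ ⟩
  (2^ k * i) * (iN * Σ)
    ≡⟨ trans (cong (_* (iN * Σ)) (*-inv (2^ k) (2^≢0 k))) (*-identityˡ (iN * Σ)) ⟩
  iN * Σ ∎
  where
  open ≡-Reasoning
  i = inv (2^ k)
  iN = inv (∣X∣ n k)
  T : Subset k → ℚ
  T S = χ-correlation n k σ S h
  Σ = (Σ[∈] nonemptySubsets k) (λ S → fourierSum Q S * T S)
  pull-out : ∀ f a b t → (f * a) * (- (t * b)) ≡ - (a * b) * (f * t)
  pull-out = solve-∀ ℚ-ring
  double-neg : ∀ p a b s → - (p * (- (a * b) * s)) ≡ (p * a) * (b * s)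
  double-neg = solve-∀ ℚ-ring
  term : ∀ S → Q̂ Q S * Γ n ∣ S ∣ σ (hS n k S h) ≡ - (i * iN) * (fourierSum Q S * T S)
  term S = trans (cong₂ _*_ (/′≡*inv (fourierSum Q S) (2^ k)) (Γ-hS n k σ S h))
                 (pull-out (fourierSum Q S) i iN (T S))

lemma5p1 : (n k : ℕ) → k ≤ n →
    (Q : Vec PM k → ℚ) → IsProbDist k Q →
    (σ : Fin n → PM) → (h : Tuple n k → ℚ) →
    Δ n k Q σ h ≡
      - (2^ k * (Σ[∈] nonemptySubsets k) (λ S → Q̂ Q S * Γ n ∣ S ∣ σ (hS n k S h)))
lemma5p1 n k _ Q (_ , ΣQ≡1) σ h = begin
  Δ n k Q σ h
    ≡⟨ cong₂ _-_ (Σ-/′ (X n k) D (λ C → Q (σ⟨ σ ⟩ C)) h) (/′≡*inv H (∣X∣ n k)) ⟩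
  E * inv D - H * inv (∣X∣ n k)
    ≡⟨ cong (λ c → E * c - H * inv (∣X∣ n k)) (sym (inv-∣X∣*2^ n k Q ΣQ≡1 σ)) ⟩
  E * (inv (∣X∣ n k) * 2^ k) - H * inv (∣X∣ n k)
    ≡⟨ collect E (inv (∣X∣ n k)) (2^ k) H ⟩
  inv (∣X∣ n k) * (2^ k * E - H)
    ≡⟨ cong (inv (∣X∣ n k) *_) (sym (Σ-nonempty-correlation n k Q ΣQ≡1 σ h)) ⟩
  inv (∣X∣ n k) * (Σ[∈] nonemptySubsets k) (λ S → fourierSum Q S * χ-correlation n k σ S h)
    ≡⟨ sym (Σ-Q̂-Γ n k Q σ h) ⟩
  - (2^ k * (Σ[∈] nonemptySubsets k) (λ S → Q̂ Q S * Γ n ∣ S ∣ σ (hS n k S h))) ∎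
  where
  open ≡-Reasoning
  D = (Σ[∈] X n k) (λ C → Q (σ⟨ σ ⟩ C))
  E = (Σ[∈] X n k) (λ C → Q (σ⟨ σ ⟩ C) * h C)
  H = (Σ[∈] X n k) h
  collect : ∀ w i p x → w * (i * p) - x * i ≡ i * (p * w - x)
  collect = solve-∀ ℚ-ring
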